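{- For $m,n\geq 0$ and $r\geq 0$, the faces of dimension $r-1$ (i.e. of cardinality $r$) of $\Gamma^+(m,n)$ are in bijection with the lattice paths from $(0,0)$ to $(m,n)$ using steps $E=(1,0)$ and $N=(0,1)$ that have exactly $r$ peaks.
   Context: Let $X=\{x_1,\dots,x_m\}$, $Y=\{y_1,\dots,y_n\}$, $\mathcal E(X,Y)=\{\{x,y\}:x\in X,y\in Y\}$. The complex $\Gamma^+(m,n)$ is the simplicial complex on vertex set $\mathcal E(X,Y)$ whose faces are the sets $\sigma$ of edges such that each letter $x_s$ or $y_t$ lies in at most one edge of $\sigma$, and if $\{x_{s_1},y_{t_1}\},\{x_{s_2},y_{t_2}\}\in\sigma$ with $s_1<s_2$ then $t_1<t_2$. A peak of such a lattice path is a lattice point on the path that is immediately preceded by an $N$ step and immediately followed by an $E$ step. -}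

module Defs where

open import Data.Nat using (ℕ; zero; suc; _+_)
open import Data.Bool using (Bool; true; false)
open import Data.Fin using (Fin) renaming (_<_ to _<ᶠ_)
open import Data.Vec using (Vec; lookup; map)
open import Data.List using (List; []; _∷_; length; filterᵇ)
open import Data.Product using (_×_)
open import Relation.Binary.PropositionalEquality using (_≡_)

-- A set of edges {x_s , y_t} of E(X,Y), X = {x_0..x_{m-1}}, Y = {y_0..y_{n-1}},
-- given by its characteristic matrix: entry (s , t) is true iff {x_s , y_t} ∈ σ.
EdgeSet : ℕ → ℕ → Set
EdgeSet m n = Vec (Vec Bool n) m

_∋_,_ : ∀ {m n} → EdgeSet m n → Fin m → Fin n → Set
σ ∋ s , t = lookup (lookup σ s) t ≡ true

countTrue : ∀ {k} → Vec Bool k → ℕ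
countTrue Vec.[] = 0
countTrue (true Vec.∷ v) = suc (countTrue v)
countTrue (false Vec.∷ v) = countTrue v

card : ∀ {m n} → EdgeSet m n → ℕ
card Vec.[] = 0
card (row Vec.∷ σ) = countTrue row + card σ

IsFace : ∀ {m n} → EdgeSet m n → Set
IsFace {m} {n} σ =
  ∀ (s₁ s₂ : Fin m) (t₁ t₂ : Fin n) → σ ∋ s₁ , t₁ → σ ∋ s₂ , t₂ →
    (s₁ ≡ s₂ → t₁ ≡ t₂) × (t₁ ≡ t₂ → s₁ ≡ s₂) × (s₁ <ᶠ s₂ → t₁ <ᶠ t₂)

-- Faces of Γ⁺(m,n) of cardinality r (dimension r - 1).
-- The proof fields are irrelevant, so faces are equal iff their edge sets are.
record Face (m n r : ℕ) : Set where
  constructor face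
  field
    edges : EdgeSet m n
    .isFace : IsFace edges
    .hasCard : card edges ≡ r

data Step : Set where
  E N : Step

isE isN : Step → Bool
isE E = true
isE N = false
isN E = false
isN N = true

peaks : List Step → ℕ
peaks (N ∷ E ∷ w) = suc (peaks (E ∷ w))
peaks (_ ∷ w) = peaks w
peaks [] = 0

record PeakPath (m n r : ℕ) : Set where
  constructor path
  field
    steps : List Step
    .endsE : length (filterᵇ isE steps) ≡ m
    .endsN : length (filterᵇ isN steps) ≡ n
    .hasPeaks : peaks steps ≡ r

module Submission where

-- Faces and paths are coded by the same data.  Reading x₀, x₁, … in order, each x_s is
-- either unmatched or matched to the (j+1)-th of the letters y still available, after
-- which that letter and the j letters before it are discarded; this is exactly the
-- condition that edges of a face increase in both coordinates.  On the path side an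
-- unmatched x_s is an E step and such a match is the run N^(j+1) E, whose last corner is
-- a peak; the letters y left at the end form a final run of N steps.  Thus the edge
-- {x_s , y_t} of a face corresponds to the peak at the lattice point (s , t + 1).

open import Defs
open import Data.Nat using (ℕ; zero; suc; _+_; _≤_; z≤n; s≤s)
open import Data.Nat.Properties using (suc-injective; ≤-pred; 0≢1+n; 1+n≢0; <⇒≱)
  renaming (_≟_ to _≟ℕ_)
open import Data.Bool using (Bool; true; false)
open import Data.Bool.Properties using () renaming (_≟_ to _≟ᵇ_)
open import Data.Fin using (Fin; toℕ) renaming (zero to fzero; suc to fsuc; _<_ to _<ᶠ_)
open import Data.Fin.Properties using () renaming (suc-injective to fsuc-injective)
open import Data.Vec using (Vec; []; _∷_; lookup; map; tail) renaming (replicate to replicateᵛ)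
open import Data.Vec.Properties using (lookup-map; lookup-replicate; map-∘; map-id)
  renaming (≡-dec to ≡-decᵛ)
open import Data.Vec.Relation.Unary.Any using (Any; here; there; any?; index)
open import Data.Vec.Relation.Unary.Any.Properties using (lookup-index)
open import Data.List using (List; []; _∷_; length; filterᵇ; replicate)
open import Data.Product using (_×_; _,_; proj₁; proj₂)
open import Data.Empty using (⊥-elim; ⊥-elim-irr)
open import Relation.Nullary using (¬_; Dec; yes; no)
open import Relation.Nullary.Decidable using (recompute)
open import Relation.Binary.PropositionalEquality
open import Function.Bundles using (_↔_; mk↔ₛ′)
open import Function.Properties.Inverse using (↔-trans)

private
  variable
    m n r : ℕ

-- skip: x unmatched;  match (there^j (here c)): x matched to the (j+1)-th available y.
data Code : ℕ → ℕ → ℕ → Set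
data MatchedCode : ℕ → ℕ → ℕ → Set

data Code where
  end   : Code 0 n 0
  skip  : Code m n r → Code (suc m) n r
  match : MatchedCode m n r → Code (suc m) n r

data MatchedCode where
  here  : Code m n r → MatchedCode m (suc n) (suc r)
  there : MatchedCode m n r → MatchedCode m (suc n) r

#E #N : List Step → ℕ
#E w = length (filterᵇ isE w)
#N w = length (filterᵇ isN w)

codePath : Code m n r → List Step
matchedPath : MatchedCode m n r → List Step
codePath (end {n}) = replicate n N
codePath (skip c) = E ∷ codePath c
codePath (match c) = N ∷ matchedPath c
matchedPath (here c) = E ∷ codePath c
matchedPath (there c) = N ∷ matchedPath c

#E-replicate-N : ∀ n → #E (replicate n N) ≡ 0
#E-replicate-N zero = refl
#E-replicate-N (suc n) = #E-replicate-N n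

#N-replicate-N : ∀ n → #N (replicate n N) ≡ n
#N-replicate-N zero = refl
#N-replicate-N (suc n) = cong suc (#N-replicate-N n)

peaks-replicate-N : ∀ n → peaks (replicate n N) ≡ 0
peaks-replicate-N zero = refl
peaks-replicate-N (suc zero) = refl
peaks-replicate-N (suc (suc n)) = peaks-replicate-N (suc n)

#E≡0⇒replicate-N : ∀ w → #E w ≡ 0 → w ≡ replicate (#N w) N
#E≡0⇒replicate-N [] _ = refl
#E≡0⇒replicate-N (N ∷ w) eq = cong (N ∷_) (#E≡0⇒replicate-N w eq)

#E≡0⇒peaks≡0 : ∀ w → #E w ≡ 0 → peaks w ≡ 0
#E≡0⇒peaks≡0 w eq = trans (cong peaks (#E≡0⇒replicate-N w eq)) (peaks-replicate-N (#N w))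

#E-codePath : (c : Code m n r) → #E (codePath c) ≡ m
#E-matchedPath : (c : MatchedCode m n r) → #E (matchedPath c) ≡ suc m
#E-codePath (end {n}) = #E-replicate-N n
#E-codePath (skip c) = cong suc (#E-codePath c)
#E-codePath (match c) = #E-matchedPath c
#E-matchedPath (here c) = cong suc (#E-codePath c)
#E-matchedPath (there c) = #E-matchedPath c

#N-codePath : (c : Code m n r) → #N (codePath c) ≡ n
#N-matchedPath : (c : MatchedCode m n r) → suc (#N (matchedPath c)) ≡ n
#N-codePath (end {n}) = #N-replicate-N n
#N-codePath (skip c) = #N-codePath c
#N-codePath (match c) = #N-matchedPath c
#N-matchedPath (here c) = cong suc (#N-codePath c)
#N-matchedPath (there c) = cong suc (#N-matchedPath c)

peaks-codePath : (c : Code m n r) → peaks (codePath c) ≡ r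
peaks-matchedPath : (c : MatchedCode m n r) → peaks (N ∷ matchedPath c) ≡ r
peaks-codePath (end {n}) = peaks-replicate-N n
peaks-codePath (skip c) = peaks-codePath c
peaks-codePath (match c) = peaks-matchedPath c
peaks-matchedPath (here c) = cong suc (peaks-codePath c)
peaks-matchedPath (there c) = peaks-matchedPath c

pathCode : ∀ m n r (w : List Step) → #E w ≡ m → #N w ≡ n → peaks w ≡ r → Code m n r
pathMatchedCode : ∀ m n r (w : List Step) →
  #E w ≡ suc m → suc (#N w) ≡ n → peaks (N ∷ w) ≡ r → MatchedCode m n r
pathCode zero n zero w _ _ _ = end
pathCode zero n (suc r) w e≡ n≡ p≡ = ⊥-elim (0≢1+n (trans (sym (#E≡0⇒peaks≡0 w e≡)) p≡))
pathCode (suc m) n r (E ∷ w) e≡ n≡ p≡ = skip (pathCode m n r w (suc-injective e≡) n≡ p≡)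
pathCode (suc m) n r (N ∷ w) e≡ n≡ p≡ = match (pathMatchedCode m n r w e≡ n≡ p≡)
pathMatchedCode m (suc n) r (N ∷ w) e≡ n≡ p≡ = there (pathMatchedCode m n r w e≡ (suc-injective n≡) p≡)
pathMatchedCode m (suc n) (suc r) (E ∷ w) e≡ n≡ p≡ =
  here (pathCode m n r w (suc-injective e≡) (suc-injective n≡) (suc-injective p≡))

codePath-pathCode : ∀ m n r w (e≡ : #E w ≡ m) (n≡ : #N w ≡ n) (p≡ : peaks w ≡ r) →
  codePath (pathCode m n r w e≡ n≡ p≡) ≡ w
matchedPath-pathMatchedCode : ∀ m n r w (e≡ : #E w ≡ suc m) (n≡ : suc (#N w) ≡ n) (p≡ : peaks (N ∷ w) ≡ r) →
  matchedPath (pathMatchedCode m n r w e≡ n≡ p≡) ≡ w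
codePath-pathCode zero n zero w e≡ n≡ p≡ = sym (trans (#E≡0⇒replicate-N w e≡) (cong (λ k → replicate k N) n≡))
codePath-pathCode zero n (suc r) w e≡ n≡ p≡ = ⊥-elim (0≢1+n (trans (sym (#E≡0⇒peaks≡0 w e≡)) p≡))
codePath-pathCode (suc m) n r (E ∷ w) e≡ n≡ p≡ = cong (E ∷_) (codePath-pathCode m n r w _ n≡ p≡)
codePath-pathCode (suc m) n r (N ∷ w) e≡ n≡ p≡ = cong (N ∷_) (matchedPath-pathMatchedCode m n r w e≡ n≡ p≡)
matchedPath-pathMatchedCode m (suc n) r (N ∷ w) e≡ n≡ p≡ = cong (N ∷_) (matchedPath-pathMatchedCode m n r w e≡ _ p≡)
matchedPath-pathMatchedCode m (suc n) (suc r) (E ∷ w) e≡ n≡ p≡ = cong (E ∷_) (codePath-pathCode m n r w _ _ _)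

pathCode-codePath : (c : Code m n r) → ∀ e≡ n≡ p≡ → pathCode m n r (codePath c) e≡ n≡ p≡ ≡ c
pathMatchedCode-matchedPath : (c : MatchedCode m n r) → ∀ e≡ n≡ p≡ →
  pathMatchedCode m n r (matchedPath c) e≡ n≡ p≡ ≡ c
pathCode-codePath end e≡ n≡ p≡ = refl
pathCode-codePath (skip c) e≡ n≡ p≡ = cong skip (pathCode-codePath c _ _ _)
pathCode-codePath (match c) e≡ n≡ p≡ = cong match (pathMatchedCode-matchedPath c _ _ _)
pathMatchedCode-matchedPath (here c) e≡ n≡ p≡ = cong here (pathCode-codePath c _ _ _)
pathMatchedCode-matchedPath (there c) e≡ n≡ p≡ = cong there (pathMatchedCode-matchedPath c _ _ _)

recomputeℕ : {a b : ℕ} → .(a ≡ b) → a ≡ b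
recomputeℕ = recompute (_ ≟ℕ _)

path-cong : ∀ {w w′ : List Step} .{e n′ p e′ n″ p′} →
  w ≡ w′ → path {m} {n} {r} w e n′ p ≡ path w′ e′ n″ p′
path-cong refl = refl

code↔peakPath : (m n r : ℕ) → Code m n r ↔ PeakPath m n r
code↔peakPath m n r = mk↔ₛ′ toPath fromPath toPath-fromPath (λ c → pathCode-codePath c _ _ _)
  where
  toPath : Code m n r → PeakPath m n r
  toPath c = path (codePath c) (#E-codePath c) (#N-codePath c) (peaks-codePath c)
  fromPath : PeakPath m n r → Code m n r
  fromPath (path w e≡ n≡ p≡) = pathCode m n r w (recomputeℕ e≡) (recomputeℕ n≡) (recomputeℕ p≡)
  toPath-fromPath : ∀ w → toPath (fromPath w) ≡ w
  toPath-fromPath (path w e≡ n≡ p≡) = path-cong (codePath-pathCode m n r w _ _ _)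

Compatible : Fin m → Fin m → Fin n → Fin n → Set
Compatible s₁ s₂ t₁ t₂ = (s₁ ≡ s₂ → t₁ ≡ t₂) × (t₁ ≡ t₂ → s₁ ≡ s₂) × (s₁ <ᶠ s₂ → t₁ <ᶠ t₂)

compatible-fsucʳ : {s₁ s₂ : Fin m} {t₁ t₂ : Fin n} →
  Compatible s₁ s₂ t₁ t₂ → Compatible s₁ s₂ (fsuc t₁) (fsuc t₂)
compatible-fsucʳ (t≡ , s≡ , t<) = (λ e → cong fsuc (t≡ e)) , (λ e → s≡ (fsuc-injective e)) , (λ l → s≤s (t< l))

compatible-fsucʳ⁻ : {s₁ s₂ : Fin m} {t₁ t₂ : Fin n} →
  Compatible s₁ s₂ (fsuc t₁) (fsuc t₂) → Compatible s₁ s₂ t₁ t₂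
compatible-fsucʳ⁻ (t≡ , s≡ , t<) = (λ e → fsuc-injective (t≡ e)) , (λ e → s≡ (cong fsuc e)) , (λ l → ≤-pred (t< l))

compatible-fsucˡ : {s₁ s₂ : Fin m} {t₁ t₂ : Fin n} →
  Compatible s₁ s₂ t₁ t₂ → Compatible (fsuc s₁) (fsuc s₂) t₁ t₂
compatible-fsucˡ (t≡ , s≡ , t<) = (λ e → t≡ (fsuc-injective e)) , (λ e → cong fsuc (s≡ e)) , (λ l → t< (≤-pred l))

compatible-fsucˡ⁻ : {s₁ s₂ : Fin m} {t₁ t₂ : Fin n} →
  Compatible (fsuc s₁) (fsuc s₂) t₁ t₂ → Compatible s₁ s₂ t₁ t₂
compatible-fsucˡ⁻ (t≡ , s≡ , t<) = (λ e → t≡ (cong fsuc e)) , (λ e → fsuc-injective (s≡ e)) , (λ l → t< (s≤s l))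

emptyRow : ∀ n → Vec Bool n
emptyRow n = replicateᵛ n false

addCol : EdgeSet m n → EdgeSet m (suc n)
addCol = map (false ∷_)

HasEdge : Vec Bool n → Set
HasEdge = Any (_≡ true)

∉-emptyRow : (t : Fin n) → lookup (emptyRow n) t ≢ true
∉-emptyRow t eq with trans (sym (lookup-replicate t false)) eq
... | ()

¬HasEdge-emptyRow : ¬ HasEdge (emptyRow n)
¬HasEdge-emptyRow {n} p = ∉-emptyRow {n} (index p) (lookup-index p)

¬HasEdge⇒emptyRow : (row : Vec Bool n) → ¬ HasEdge row → row ≡ emptyRow n
¬HasEdge⇒emptyRow [] _ = refl
¬HasEdge⇒emptyRow (true ∷ row) ¬p = ⊥-elim (¬p (here refl))
¬HasEdge⇒emptyRow (false ∷ row) ¬p = cong (false ∷_) (¬HasEdge⇒emptyRow row (λ p → ¬p (there p)))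

lookup-addCol : (σ : EdgeSet m n) → ∀ s t → lookup (lookup (addCol σ) s) t ≡ lookup (false ∷ lookup σ s) t
lookup-addCol σ s t = cong (λ row → lookup row t) (lookup-map s (false ∷_) σ)

∉-addCol-fzero : (σ : EdgeSet m n) → ∀ s → ¬ (addCol σ ∋ s , fzero)
∉-addCol-fzero σ s h with trans (sym (lookup-addCol σ s fzero)) h
... | ()

lookup-map-tail : (σ : EdgeSet m (suc n)) → ∀ s t → lookup (lookup (map tail σ) s) t ≡ lookup (lookup σ s) (fsuc t)
lookup-map-tail ((_ ∷ _) ∷ σ) fzero t = refl
lookup-map-tail (_ ∷ σ) (fsuc s) t = lookup-map-tail σ s t

map-tail-addCol : (σ : EdgeSet m n) → map tail (addCol σ) ≡ σ
map-tail-addCol σ = trans (sym (map-∘ tail (false ∷_) σ)) (map-id σ)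

addCol-map-tail : (σ : EdgeSet m (suc n)) → (∀ s → ¬ σ ∋ s , fzero) → addCol (map tail σ) ≡ σ
addCol-map-tail [] _ = refl
addCol-map-tail ((true ∷ row) ∷ σ) col₀ = ⊥-elim (col₀ fzero refl)
addCol-map-tail ((false ∷ row) ∷ σ) col₀ = cong ((false ∷ row) ∷_) (addCol-map-tail σ (λ s → col₀ (fsuc s)))

countTrue-emptyRow : ∀ n → countTrue (emptyRow n) ≡ 0
countTrue-emptyRow zero = refl
countTrue-emptyRow (suc n) = countTrue-emptyRow n

card-addCol : (σ : EdgeSet m n) → card (addCol σ) ≡ card σ
card-addCol [] = refl
card-addCol (row ∷ σ) = cong (countTrue row +_) (card-addCol σ)

card-map-tail : (σ : EdgeSet m (suc n)) → (∀ s → ¬ σ ∋ s , fzero) → card (map tail σ) ≡ card σ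
card-map-tail σ col₀ = trans (sym (card-addCol (map tail σ))) (cong card (addCol-map-tail σ col₀))

isFace-addCol : (σ : EdgeSet m n) → IsFace σ → IsFace (addCol σ)
isFace-addCol σ f s₁ s₂ fzero t₂ h₁ h₂ = ⊥-elim (∉-addCol-fzero σ s₁ h₁)
isFace-addCol σ f s₁ s₂ (fsuc t₁) fzero h₁ h₂ = ⊥-elim (∉-addCol-fzero σ s₂ h₂)
isFace-addCol σ f s₁ s₂ (fsuc t₁) (fsuc t₂) h₁ h₂ =
  compatible-fsucʳ (f s₁ s₂ t₁ t₂ (trans (sym (lookup-addCol σ s₁ (fsuc t₁))) h₁)
                                  (trans (sym (lookup-addCol σ s₂ (fsuc t₂))) h₂))

isFace-map-tail : (σ : EdgeSet m (suc n)) → IsFace σ → IsFace (map tail σ)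
isFace-map-tail σ f s₁ s₂ t₁ t₂ h₁ h₂ =
  compatible-fsucʳ⁻ (f s₁ s₂ (fsuc t₁) (fsuc t₂) (trans (sym (lookup-map-tail σ s₁ t₁)) h₁)
                                                  (trans (sym (lookup-map-tail σ s₂ t₂)) h₂))

isFace-emptyRow : (σ : EdgeSet m n) → IsFace σ → IsFace (emptyRow n ∷ σ)
isFace-emptyRow σ f fzero s₂ t₁ t₂ h₁ h₂ = ⊥-elim (∉-emptyRow t₁ h₁)
isFace-emptyRow σ f (fsuc s₁) fzero t₁ t₂ h₁ h₂ = ⊥-elim (∉-emptyRow t₂ h₂)
isFace-emptyRow σ f (fsuc s₁) (fsuc s₂) t₁ t₂ h₁ h₂ = compatible-fsucˡ (f s₁ s₂ t₁ t₂ h₁ h₂)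

isFace-tail : (row : Vec Bool n) (σ : EdgeSet m n) → IsFace (row ∷ σ) → IsFace σ
isFace-tail row σ f s₁ s₂ t₁ t₂ h₁ h₂ = compatible-fsucˡ⁻ (f (fsuc s₁) (fsuc s₂) t₁ t₂ h₁ h₂)

isFace-corner : (σ : EdgeSet m n) → IsFace σ → IsFace ((true ∷ emptyRow n) ∷ addCol σ)
isFace-corner σ f fzero fzero fzero fzero _ _ = (λ _ → refl) , (λ _ → refl) , (λ ())
isFace-corner σ f fzero s₂ (fsuc t₁) t₂ h₁ _ = ⊥-elim (∉-emptyRow t₁ h₁)
isFace-corner σ f s₁ fzero t₁ (fsuc t₂) _ h₂ = ⊥-elim (∉-emptyRow t₂ h₂)
isFace-corner σ f fzero (fsuc s₂) fzero fzero _ h₂ = ⊥-elim (∉-addCol-fzero σ s₂ h₂)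
isFace-corner σ f (fsuc s₁) fzero fzero fzero h₁ _ = ⊥-elim (∉-addCol-fzero σ s₁ h₁)
isFace-corner σ f fzero (fsuc s₂) fzero (fsuc t₂) _ _ = (λ ()) , (λ ()) , (λ _ → s≤s z≤n)
isFace-corner σ f (fsuc s₁) fzero (fsuc t₁) fzero _ _ = (λ ()) , (λ ()) , (λ ())
isFace-corner σ f (fsuc s₁) (fsuc s₂) t₁ t₂ h₁ h₂ = compatible-fsucˡ (isFace-addCol σ f s₁ s₂ t₁ t₂ h₁ h₂)

codeFace : Code m n r → EdgeSet m n
matchedRow : MatchedCode m n r → Vec Bool n
matchedRest : MatchedCode m n r → EdgeSet m n
codeFace end = []
codeFace (skip {n = n} c) = emptyRow n ∷ codeFace c
codeFace (match c) = matchedRow c ∷ matchedRest c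
matchedRow (here {n = n} c) = true ∷ emptyRow n
matchedRow (there c) = false ∷ matchedRow c
matchedRest (here c) = addCol (codeFace c)
matchedRest (there c) = addCol (matchedRest c)

matchedFace : MatchedCode m n r → EdgeSet (suc m) n
matchedFace c = matchedRow c ∷ matchedRest c

HasEdge-matchedRow : (c : MatchedCode m n r) → HasEdge (matchedRow c)
HasEdge-matchedRow (here c) = here refl
HasEdge-matchedRow (there c) = there (HasEdge-matchedRow c)

card-codeFace : (c : Code m n r) → card (codeFace c) ≡ r
card-matchedFace : (c : MatchedCode m n r) → card (matchedFace c) ≡ r
card-codeFace end = refl
card-codeFace (skip {n = n} c) rewrite countTrue-emptyRow n = card-codeFace c
card-codeFace (match c) = card-matchedFace c
card-matchedFace (here {n = n} c) rewrite countTrue-emptyRow n | card-addCol (codeFace c) = cong suc (card-codeFace c)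
card-matchedFace (there c) rewrite card-addCol (matchedRest c) = card-matchedFace c

isFace-codeFace : (c : Code m n r) → IsFace (codeFace c)
isFace-matchedFace : (c : MatchedCode m n r) → IsFace (matchedFace c)
isFace-codeFace end ()
isFace-codeFace (skip c) = isFace-emptyRow (codeFace c) (isFace-codeFace c)
isFace-codeFace (match c) = isFace-matchedFace c
isFace-matchedFace (here c) = isFace-corner (codeFace c) (isFace-codeFace c)
isFace-matchedFace (there c) = isFace-addCol (matchedFace c) (isFace-matchedFace c)

¬HasEdge-right-of-corner : (row : Vec Bool n) (σ : EdgeSet m (suc n)) →
  IsFace ((true ∷ row) ∷ σ) → ¬ HasEdge row
¬HasEdge-right-of-corner row σ f p with proj₁ (f fzero fzero fzero (fsuc (index p)) refl (lookup-index p)) refl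
... | ()

∉-below-left-of-edge : (row : Vec Bool n) (σ : EdgeSet m n) {t t′ : Fin n} →
  IsFace (row ∷ σ) → lookup row t ≡ true → toℕ t′ ≤ toℕ t → ∀ s → ¬ σ ∋ s , t′
∉-below-left-of-edge row σ {t} {t′} f h t′≤t s h′ =
  <⇒≱ (proj₂ (proj₂ (f fzero (fsuc s) t t′ h h′)) (s≤s z≤n)) t′≤t

card-unmatched : (row : Vec Bool n) (σ : EdgeSet m n) →
  ¬ HasEdge row → card (row ∷ σ) ≡ r → card σ ≡ r
card-unmatched {n = n} row σ ¬p c rewrite ¬HasEdge⇒emptyRow row ¬p | countTrue-emptyRow n = c

card-corner : (row : Vec Bool n) (σ : EdgeSet m (suc n)) →
  IsFace ((true ∷ row) ∷ σ) → card ((true ∷ row) ∷ σ) ≡ suc r → card (map tail σ) ≡ r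
card-corner {n = n} row σ f c
  rewrite card-map-tail σ (∉-below-left-of-edge (true ∷ row) σ {fzero} f refl z≤n)
        | ¬HasEdge⇒emptyRow row (¬HasEdge-right-of-corner row σ f)
        | countTrue-emptyRow n
  = suc-injective c

card-shifted : (row : Vec Bool n) (σ : EdgeSet m (suc n)) →
  IsFace ((false ∷ row) ∷ σ) → HasEdge row → card ((false ∷ row) ∷ σ) ≡ r → card (row ∷ map tail σ) ≡ r
card-shifted row σ f p c
  rewrite card-map-tail σ (∉-below-left-of-edge (false ∷ row) σ {fsuc (index p)} f (lookup-index p) z≤n) = c

-- The cons clause comes first, so that faceCode r (row ∷ σ) reduces for a variable r.
faceCode : ∀ r (σ : EdgeSet m n) → .(IsFace σ) → .(card σ ≡ r) → Code m n r
rowCode : ∀ r (row : Vec Bool n) (σ : EdgeSet m n) → Dec (HasEdge row) →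
  .(IsFace (row ∷ σ)) → .(card (row ∷ σ) ≡ r) → Code (suc m) n r
matchedCode : ∀ r (row : Vec Bool n) (σ : EdgeSet m n) → HasEdge row →
  .(IsFace (row ∷ σ)) → .(card (row ∷ σ) ≡ r) → MatchedCode m n r
faceCode r (row ∷ σ) f c = rowCode r row σ (any? (_≟ᵇ true) row) f c
faceCode zero [] _ _ = end
faceCode (suc r) [] _ c = ⊥-elim-irr (0≢1+n c)
rowCode r row σ (no ¬p) f c = skip (faceCode r σ (isFace-tail row σ f) (card-unmatched row σ ¬p c))
rowCode r row σ (yes p) f c = match (matchedCode r row σ p f c)
matchedCode r (false ∷ row) σ (there p) f c =
  there (matchedCode r row (map tail σ) p (isFace-map-tail ((false ∷ row) ∷ σ) f) (card-shifted row σ f p c))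
matchedCode zero (true ∷ row) σ _ f c = ⊥-elim-irr (1+n≢0 c)
matchedCode (suc r) (true ∷ row) σ _ f c =
  here (faceCode r (map tail σ) (isFace-map-tail σ (isFace-tail (true ∷ row) σ f)) (card-corner row σ f c))

codeFace-faceCode : ∀ r (σ : EdgeSet m n) (f : IsFace σ) .(c : card σ ≡ r) →
  codeFace (faceCode r σ f c) ≡ σ
codeFace-rowCode : ∀ r (row : Vec Bool n) (σ : EdgeSet m n) (d : Dec (HasEdge row))
  (f : IsFace (row ∷ σ)) .(c : card (row ∷ σ) ≡ r) → codeFace (rowCode r row σ d f c) ≡ row ∷ σ
matchedFace-matchedCode : ∀ r (row : Vec Bool n) (σ : EdgeSet m n) (p : HasEdge row)
  (f : IsFace (row ∷ σ)) .(c : card (row ∷ σ) ≡ r) →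
  matchedFace (matchedCode r row σ p f c) ≡ row ∷ σ
codeFace-faceCode r (row ∷ σ) f c = codeFace-rowCode r row σ (any? (_≟ᵇ true) row) f c
codeFace-faceCode zero [] f c = refl
codeFace-faceCode (suc r) [] f c = ⊥-elim-irr (0≢1+n c)
codeFace-rowCode r row σ (no ¬p) f c =
  cong₂ _∷_ (sym (¬HasEdge⇒emptyRow row ¬p)) (codeFace-faceCode r σ (isFace-tail row σ f) _)
codeFace-rowCode r row σ (yes p) f c = matchedFace-matchedCode r row σ p f c
matchedFace-matchedCode r (false ∷ row) σ (there p) f c =
  begin
    addCol (matchedFace c′)   ≡⟨ cong addCol (matchedFace-matchedCode r row (map tail σ) p f′ _) ⟩
    addCol (row ∷ map tail σ) ≡⟨ cong ((false ∷ row) ∷_) (addCol-map-tail σ col₀-empty) ⟩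
    (false ∷ row) ∷ σ         ∎
  where
  open ≡-Reasoning
  f′ = isFace-map-tail ((false ∷ row) ∷ σ) f
  c′ = matchedCode r row (map tail σ) p f′ (card-shifted row σ f p c)
  col₀-empty = ∉-below-left-of-edge (false ∷ row) σ {fsuc (index p)} f (lookup-index p) z≤n
matchedFace-matchedCode zero (true ∷ row) σ _ f c = ⊥-elim-irr (1+n≢0 c)
matchedFace-matchedCode (suc r) (true ∷ row) σ _ f c =
  cong₂ _∷_ (cong (true ∷_) (sym (¬HasEdge⇒emptyRow row (¬HasEdge-right-of-corner row σ f))))
            (begin
              addCol (codeFace c′) ≡⟨ cong addCol (codeFace-faceCode r (map tail σ) f′ _) ⟩
              addCol (map tail σ)  ≡⟨ addCol-map-tail σ col₀-empty ⟩
              σ                    ∎)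
  where
  open ≡-Reasoning
  f′ = isFace-map-tail σ (isFace-tail (true ∷ row) σ f)
  c′ = faceCode r (map tail σ) f′ (card-corner row σ f c)
  col₀-empty = ∉-below-left-of-edge (true ∷ row) σ {fzero} f refl z≤n

faceCode-cong : ∀ r {σ σ′ : EdgeSet m n} .{f f′ c c′} → σ ≡ σ′ → faceCode r σ f c ≡ faceCode r σ′ f′ c′
faceCode-cong r refl = refl

matchedCode-cong : ∀ r (row : Vec Bool n) {σ σ′ : EdgeSet m n} (p : HasEdge row) .{f f′ c c′} →
  σ ≡ σ′ → matchedCode r row σ p f c ≡ matchedCode r row σ′ p f′ c′
matchedCode-cong r row p refl = refl

faceCode-codeFace : (c : Code m n r) .(f : IsFace (codeFace c)) .(cc : card (codeFace c) ≡ r) →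
  faceCode r (codeFace c) f cc ≡ c
matchedCode-matchedFace : (c : MatchedCode m n r) (p : HasEdge (matchedRow c))
  .(f : IsFace (matchedFace c)) .(cc : card (matchedFace c) ≡ r) →
  matchedCode r (matchedRow c) (matchedRest c) p f cc ≡ c
faceCode-codeFace end f cc = refl
faceCode-codeFace (skip {n = n} c) f cc with any? (_≟ᵇ true) (emptyRow n)
... | yes p = ⊥-elim (¬HasEdge-emptyRow p)
... | no _ = cong skip (faceCode-codeFace c _ _)
faceCode-codeFace (match c) f cc with any? (_≟ᵇ true) (matchedRow c)
... | yes p = cong match (matchedCode-matchedFace c p f cc)
... | no ¬p = ⊥-elim (¬p (HasEdge-matchedRow c))
matchedCode-matchedFace (here c) p f cc =
  cong here (trans (faceCode-cong _ (map-tail-addCol (codeFace c)))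
                   (faceCode-codeFace c (isFace-codeFace c) (card-codeFace c)))
matchedCode-matchedFace (there c) (there p) f cc =
  cong there (trans (matchedCode-cong _ _ p (map-tail-addCol (matchedRest c)))
                    (matchedCode-matchedFace c p (isFace-matchedFace c) (card-matchedFace c)))

face-cong : ∀ {σ σ′ : EdgeSet m n} .{f c f′ c′} → σ ≡ σ′ → face {m} {n} {r} σ f c ≡ face σ′ f′ c′
face-cong refl = refl

face↔code : (m n r : ℕ) → Face m n r ↔ Code m n r
face↔code m n r = mk↔ₛ′ toCode fromCode (λ c → faceCode-codeFace c _ _) fromCode-toCode
  where
  toCode : Face m n r → Code m n r
  toCode (face σ f c) = faceCode r σ f c
  fromCode : Code m n r → Face m n r
  fromCode c = face (codeFace c) (isFace-codeFace c) (card-codeFace c)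
  fromCode-toCode : ∀ F → fromCode (toCode F) ≡ F
  -- f is irrelevant here, but the resulting equation of Boolean matrices is decidable.
  fromCode-toCode (face σ f c) = face-cong (recompute (≡-decᵛ (≡-decᵛ _≟ᵇ_) _ σ) (codeFace-faceCode r σ f c))

proposition3p24 : (m n r : ℕ) → Face m n r ↔ PeakPath m n r
proposition3p24 m n r = ↔-trans (face↔code m n r) (code↔peakPath m n r)
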